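{- Let $k\ge1$. The order of whirling $w$ on $\mathcal{F}_k({\sf V})$ divides $2(k+2)$.
   Context: ${\sf V}$ is the poset with elements $c,\ell,r$ and relations $c<\ell$, $c<r$. $\mathcal{F}_k({\sf V})$ is the set of functions $f:{\sf V}\to\{0,\dots,k\}$ with $f(\ell)\le f(c)$, $f(r)\le f(c)$. For $x\in{\sf V}$, the whirl $w_x$ repeatedly adds $1$ modulo $k+1$ to $f(x)$ (other values unchanged) until the result lies in $\mathcal{F}_k({\sf V})$; $w=w_c\circ w_r\circ w_\ell$. -}

module Defs where

open import Data.Nat using (ℕ; zero; suc; _*_; _+_; _%_)
open import Data.Nat.DivMod using (m%n<n)
open import Data.Fin using (Fin; toℕ; fromℕ<) renaming (_≤_ to _≤ᶠ_)
open import Data.Fin.Properties using () renaming (_≤?_ to _≤ᶠ?_)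
open import Data.Product using (_×_)
open import Relation.Nullary using (Dec; yes; no)
open import Relation.Nullary.Decidable using (_×-dec_)

-- The poset V = {c, ℓ, r} with c < ℓ and c < r.
data V : Set where
  c ℓ r : V

Fun : ℕ → Set
Fun k = V → Fin (suc k)

InF : ∀ {k} → Fun k → Set
InF f = (f ℓ ≤ᶠ f c) × (f r ≤ᶠ f c)

inF? : ∀ {k} (f : Fun k) → Dec (InF f)
inF? f = (f ℓ ≤ᶠ? f c) ×-dec (f r ≤ᶠ? f c)

inc : ∀ {k} → Fin (suc k) → Fin (suc k)
inc {k} i = fromℕ< (m%n<n (suc (toℕ i)) (suc k))

update : ∀ {k} → Fun k → V → Fin (suc k) → Fun k
update f c v c = v
update f c v ℓ = f ℓ
update f c v r = f r
update f ℓ v c = f c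
update f ℓ v ℓ = v
update f ℓ v r = f r
update f r v c = f c
update f r v ℓ = f ℓ
update f r v r = v

-- repeatedly add 1 mod (k+1) at x until the result lies in F_k(V);
-- 'fuel' bounds the number of attempts (k+1 attempts always suffice for
-- f ∈ F_k(V), since after k+1 increments f itself is reached again).
whirlLoop : ∀ {k} → ℕ → V → Fun k → Fun k
whirlLoop zero    x f = f
whirlLoop (suc n) x f with inF? (update f x (inc (f x)))
... | yes _ = update f x (inc (f x))
... | no  _ = whirlLoop n x (update f x (inc (f x)))

whirlAt : ∀ {k} → V → Fun k → Fun k
whirlAt {k} x f = whirlLoop (suc k) x f

whirl : ∀ {k} → Fun k → Fun k
whirl f = whirlAt c (whirlAt r (whirlAt ℓ f))

iter : ∀ {A : Set} → ℕ → (A → A) → A → A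
iter zero    g a = a
iter (suc n) g a = g (iter n g a)

{-# OPTIONS --safe #-}
module Submission where

-- Encode f ∈ F_k(V) by the triple (f c , f ℓ , f r). While both leaves are below the root and
-- the root is below k, one whirl adds 1 to all three values; so every admissible triple lies on
-- the forward orbit of a corner (a , a , d), its mirror image (a , d , a), or a diagonal
-- (a , a , a). From a corner with d < a, write a = d + p + 1 and k = a + q: after q + 1 whirls
-- one reaches the mirrored corner (q + d + 1 , q , q + d + 1), i.e. the gaps (d , p , q) are
-- rotated and the leaves exchanged. Three such runs, k + 2 whirls in all, lead to (a , d , a);
-- a diagonal (a , a , a) passes through (q , q , q) and returns after k + 2 whirls as well. Thus
-- w^(k+2) exchanges f ℓ and f r, and w^(2(k+2)) is the identity.

open import Defs
open import Data.Nat using (ℕ; _≤_; _*_; _+_)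
open import Relation.Binary.PropositionalEquality using (_≡_)
open import Data.Bool using (if_then_else_)
open import Data.Empty using (⊥-elim)
open import Data.Fin using (Fin; toℕ)
open import Data.Fin.Properties using (toℕ-fromℕ<; toℕ≤pred[n]; toℕ-injective)
open import Data.Nat using (zero; suc; _<_; _∸_; _%_; _⊔_; _<?_; z≤n; s≤s; z<s)
open import Data.Nat.DivMod using (m<n⇒m%n≡m; n%n≡0)
open import Data.Nat.Properties
open import Data.Nat.Tactic.RingSolver using (solve-∀)
open import Data.Product using (_×_; _,_; proj₁; proj₂; ∃-syntax)
open import Data.Sum using (inj₁; inj₂)
open import Function using (_∘_)
open import Relation.Binary.PropositionalEquality
  using (refl; sym; trans; cong; cong₂; subst; subst₂; _≗_; module ≡-Reasoning)
open import Relation.Nullary using (¬_; yes; no; does)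
open import Relation.Nullary.Decidable using (dec-true; dec-false)

open ≡-Reasoning

iter-+ : ∀ {A : Set} m n (h : A → A) a → iter (m + n) h a ≡ iter m h (iter n h a)
iter-+ zero    n h a = refl
iter-+ (suc m) n h a = cong h (iter-+ m n h a)

iter-commute : ∀ {A : Set} {h g : A → A} → (∀ a → h (g a) ≡ g (h a)) →
               ∀ n a → iter n h (g a) ≡ g (iter n h a)
iter-commute         comm zero    a = refl
iter-commute {h = h} comm (suc n) a = trans (cong h (iter-commute comm n a)) (comm (iter n h a))

iter-suc-inner : ∀ {A : Set} n (h : A → A) a → iter (suc n) h a ≡ iter n h (h a)
iter-suc-inner n h a = sym (iter-commute {h = h} {g = h} (λ _ → refl) n a)

-- (a , b , d) stands for (f c , f ℓ , f r). A leaf whirls to the next value ≤ a in cyclic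
-- order, i.e. to bump a b; the root to the next value ≥ both leaves, i.e. to a + 1 or, when
-- a = k, round to the larger leaf.
Triple : Set
Triple = ℕ × ℕ × ℕ

bump : ℕ → ℕ → ℕ
bump a b = if does (b <? a) then suc b else 0

raise : ℕ → ℕ → ℕ → ℕ
raise k a m = if does (a <? k) then suc a else m

whirlAtᵗ : ℕ → V → Triple → Triple
whirlAtᵗ k c (a , b , d) = raise k a (b ⊔ d) , b , d
whirlAtᵗ k ℓ (a , b , d) = a , bump a b , d
whirlAtᵗ k r (a , b , d) = a , b , bump a d

whirlᵗ : ℕ → Triple → Triple
whirlᵗ k = whirlAtᵗ k c ∘ whirlAtᵗ k r ∘ whirlAtᵗ k ℓ

swapLeaves : Triple → Triple
swapLeaves (a , b , d) = a , d , b

bump-< : ∀ {a b} → b < a → bump a b ≡ suc b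
bump-< {a} {b} b<a rewrite dec-true (b <? a) b<a = refl

bump-≥ : ∀ {a b} → a ≤ b → bump a b ≡ 0
bump-≥ {a} {b} a≤b rewrite dec-false (b <? a) (≤⇒≯ a≤b) = refl

raise-< : ∀ {k a m} → a < k → raise k a m ≡ suc a
raise-< {k} {a} a<k rewrite dec-true (a <? k) a<k = refl

raise-≥ : ∀ {k a m} → k ≤ a → raise k a m ≡ m
raise-≥ {k} {a} k≤a rewrite dec-false (a <? k) (≤⇒≯ k≤a) = refl

whirlᵗ-swapLeaves : ∀ k s → whirlᵗ k (swapLeaves s) ≡ swapLeaves (whirlᵗ k s)
whirlᵗ-swapLeaves k (a , b , d) =
  cong (λ m → raise k a m , bump a d , bump a b) (⊔-comm (bump a d) (bump a b))

iter-whirlᵗ-swapLeaves : ∀ k n s →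
                         iter n (whirlᵗ k) (swapLeaves s) ≡ swapLeaves (iter n (whirlᵗ k) s)
iter-whirlᵗ-swapLeaves k = iter-commute {h = whirlᵗ k} {g = swapLeaves} (whirlᵗ-swapLeaves k)

whirlᵗ-below : ∀ {k a b d} → a < k → whirlᵗ k (a , b , d) ≡ (suc a , bump a b , bump a d)
whirlᵗ-below a<k = cong (λ a′ → a′ , _ , _) (raise-< a<k)

whirlᵗ-top : ∀ {k a b d} → k ≤ a → b < a → d < a →
             whirlᵗ k (a , b , d) ≡ (suc b ⊔ suc d , suc b , suc d)
whirlᵗ-top k≤a b<a d<a rewrite bump-< b<a | bump-< d<a = cong (λ a′ → a′ , _ , _) (raise-≥ k≤a)

whirlᵗ-interior : ∀ {k a b d} j → b < a → d < a → j + a ≤ k →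
                  iter j (whirlᵗ k) (a , b , d) ≡ (j + a , j + b , j + d)
whirlᵗ-interior zero _ _ _ = refl
whirlᵗ-interior {k} {a} {b} {d} (suc j) b<a d<a j+a<k = begin
  whirlᵗ k (iter j (whirlᵗ k) (a , b , d)) ≡⟨ cong (whirlᵗ k) (whirlᵗ-interior j b<a d<a (<⇒≤ j+a<k)) ⟩
  whirlᵗ k (j + a , j + b , j + d)          ≡⟨ whirlᵗ-below j+a<k ⟩
  (suc (j + a) , bump (j + a) (j + b) , bump (j + a) (j + d))
    ≡⟨ cong₂ (λ b′ d′ → suc (j + a) , b′ , d′) (bump-< (+-monoʳ-< j b<a)) (bump-< (+-monoʳ-< j d<a)) ⟩
  (suc (j + a) , suc (j + b) , suc (j + d)) ∎

whirlᵗ-corner : ∀ {k a d} → a < k → whirlᵗ k (a , a , d) ≡ (suc a , 0 , bump a d)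
whirlᵗ-corner {a = a} {d} a<k =
  trans (whirlᵗ-below a<k) (cong (λ b → suc a , b , bump a d) (bump-≥ ≤-refl))

corner-run : ∀ {k a d} q → d < a → q + a ≡ k →
             iter (suc q) (whirlᵗ k) (a , a , d) ≡ swapLeaves (suc (q + d) , suc (q + d) , q)
corner-run {a = a} {d} zero d<a refl
  rewrite bump-≥ {a} ≤-refl | bump-< d<a | raise-≥ {a} {a} {suc d} ≤-refl = refl
corner-run {k} {a} {d} (suc q) d<a refl = begin
  whirlᵗ k (iter (suc q) (whirlᵗ k) (a , a , d))  ≡⟨ cong (whirlᵗ k) (iter-suc-inner q (whirlᵗ k) _) ⟩
  whirlᵗ k (iter q (whirlᵗ k) (whirlᵗ k (a , a , d)))
    ≡⟨ cong (whirlᵗ k ∘ iter q (whirlᵗ k)) leave-corner ⟩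
  whirlᵗ k (iter q (whirlᵗ k) (suc a , 0 , suc d))
    ≡⟨ cong (whirlᵗ k) (whirlᵗ-interior q z<s (s≤s d<a) (≤-reflexive (+-suc q a))) ⟩
  whirlᵗ k (q + suc a , q + 0 , q + suc d)
    ≡⟨ whirlᵗ-top (≤-reflexive (sym (+-suc q a))) (+-monoʳ-< q z<s) (+-monoʳ-< q (s≤s d<a)) ⟩
  (suc (q + 0) ⊔ suc (q + suc d) , suc (q + 0) , suc (q + suc d))
    ≡⟨ cong₂ (λ b e → suc b ⊔ suc e , suc b , suc e) (+-identityʳ q) (+-suc q d) ⟩
  (suc q ⊔ suc (suc (q + d)) , suc q , suc (suc (q + d)))
    ≡⟨ cong (λ a′ → a′ , suc q , suc (suc (q + d))) (m≤n⇒m⊔n≡n (s≤s (m≤n⇒m≤1+n (m≤m+n q d)))) ⟩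
  (suc (suc q + d) , suc q , suc (suc q + d)) ∎
  where
  leave-corner : whirlᵗ k (a , a , d) ≡ (suc a , 0 , suc d)
  leave-corner = trans (whirlᵗ-corner (s≤s (m≤n+m a q))) (cong (λ d′ → suc a , 0 , d′) (bump-< d<a))

diagonal-run : ∀ {k a} q → q + a ≡ k → iter (suc q) (whirlᵗ k) (a , a , a) ≡ (q , q , q)
diagonal-run {a = a} zero refl rewrite bump-≥ {a} ≤-refl | raise-≥ {a} {a} {0} ≤-refl = refl
diagonal-run {k} {a} (suc q) refl = begin
  whirlᵗ k (iter (suc q) (whirlᵗ k) (a , a , a))  ≡⟨ cong (whirlᵗ k) (iter-suc-inner q (whirlᵗ k) _) ⟩
  whirlᵗ k (iter q (whirlᵗ k) (whirlᵗ k (a , a , a)))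
    ≡⟨ cong (whirlᵗ k ∘ iter q (whirlᵗ k)) leave-diagonal ⟩
  whirlᵗ k (iter q (whirlᵗ k) (suc a , 0 , 0))
    ≡⟨ cong (whirlᵗ k) (whirlᵗ-interior q z<s z<s (≤-reflexive (+-suc q a))) ⟩
  whirlᵗ k (q + suc a , q + 0 , q + 0)
    ≡⟨ whirlᵗ-top (≤-reflexive (sym (+-suc q a))) (+-monoʳ-< q z<s) (+-monoʳ-< q z<s) ⟩
  (suc (q + 0) ⊔ suc (q + 0) , suc (q + 0) , suc (q + 0))
    ≡⟨ cong (λ b → suc b ⊔ suc b , suc b , suc b) (+-identityʳ q) ⟩
  (suc q ⊔ suc q , suc q , suc q) ≡⟨ cong (λ a′ → a′ , suc q , suc q) (⊔-idem (suc q)) ⟩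
  (suc q , suc q , suc q) ∎
  where
  leave-diagonal : whirlᵗ k (a , a , a) ≡ (suc a , 0 , 0)
  leave-diagonal = trans (whirlᵗ-corner (s≤s (m≤n+m a q))) (cong (λ d → suc a , 0 , d) (bump-≥ ≤-refl))

HalfPeriodic : ℕ → Triple → Set
HalfPeriodic k s = iter (k + 2) (whirlᵗ k) s ≡ swapLeaves s

halfPeriodic-whirlᵗ : ∀ {k s} → HalfPeriodic k s → HalfPeriodic k (whirlᵗ k s)
halfPeriodic-whirlᵗ {k} {s} half = begin
  iter (k + 2) (whirlᵗ k) (whirlᵗ k s) ≡⟨ sym (iter-suc-inner (k + 2) (whirlᵗ k) s) ⟩
  whirlᵗ k (iter (k + 2) (whirlᵗ k) s) ≡⟨ cong (whirlᵗ k) half ⟩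
  whirlᵗ k (swapLeaves s)              ≡⟨ whirlᵗ-swapLeaves k s ⟩
  swapLeaves (whirlᵗ k s)              ∎

halfPeriodic-swapLeaves : ∀ {k s} → HalfPeriodic k s → HalfPeriodic k (swapLeaves s)
halfPeriodic-swapLeaves {k} {s} half =
  trans (iter-whirlᵗ-swapLeaves k (k + 2) s) (cong swapLeaves half)

halfPeriodic-corner : ∀ {k a d} → d < a → a ≤ k → HalfPeriodic k (a , a , d)
halfPeriodic-corner {k} {a} {d} d<a a≤k with m≤n⇒∃[o]m+o≡n d<a | m≤n⇒∃[o]m+o≡n a≤k
... | p , refl | q , refl = begin
  iter (k + 2) W (a , a , d)
    ≡⟨ cong (λ n → iter n W (a , a , d)) (three-runs d p q) ⟩
  iter (suc d + (suc p + suc q)) W (a , a , d)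
    ≡⟨ trans (iter-+ (suc d) _ W _) (cong (iter (suc d) W) (iter-+ (suc p) (suc q) W _)) ⟩
  iter (suc d) W (iter (suc p) W (iter (suc q) W (a , a , d)))
    ≡⟨ cong (iter (suc d) W ∘ iter (suc p) W) (corner-run q d<a (+-comm q a)) ⟩
  iter (suc d) W (iter (suc p) W (swapLeaves (suc (q + d) , suc (q + d) , q)))
    ≡⟨ cong (iter (suc d) W) (iter-whirlᵗ-swapLeaves k (suc p) _) ⟩
  iter (suc d) W (swapLeaves (iter (suc p) W (suc (q + d) , suc (q + d) , q)))
    ≡⟨ cong (iter (suc d) W ∘ swapLeaves) (corner-run p (s≤s (m≤m+n q d)) (gap₂ d p q)) ⟩
  iter (suc d) W (suc (p + q) , suc (p + q) , p)
    ≡⟨ corner-run d (s≤s (m≤m+n p q)) (gap₃ d p q) ⟩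
  swapLeaves (a , a , d) ∎
  where
  W = whirlᵗ k
  three-runs : ∀ d p q → suc (d + p + q) + 2 ≡ suc d + (suc p + suc q)
  three-runs = solve-∀
  gap₂ : ∀ d p q → p + suc (q + d) ≡ suc (d + p + q)
  gap₂ = solve-∀
  gap₃ : ∀ d p q → d + suc (p + q) ≡ suc (d + p + q)
  gap₃ = solve-∀

halfPeriodic-diagonal : ∀ {k a} → a ≤ k → HalfPeriodic k (a , a , a)
halfPeriodic-diagonal {k} {a} a≤k with m≤n⇒∃[o]m+o≡n a≤k
... | q , refl = begin
  iter (k + 2) W (a , a , a)                    ≡⟨ cong (λ n → iter n W (a , a , a)) (two-runs a q) ⟩
  iter (suc a + suc q) W (a , a , a)            ≡⟨ iter-+ (suc a) (suc q) W _ ⟩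
  iter (suc a) W (iter (suc q) W (a , a , a))   ≡⟨ cong (iter (suc a) W) (diagonal-run q (+-comm q a)) ⟩
  iter (suc a) W (q , q , q)                    ≡⟨ diagonal-run a refl ⟩
  (a , a , a)                                   ∎
  where
  W = whirlᵗ k
  two-runs : ∀ a q → a + q + 2 ≡ suc a + suc q
  two-runs = solve-∀

unbump : ℕ → ℕ → ℕ
unbump a zero    = a
unbump a (suc b) = b

bump-unbump : ∀ {a b} → b ≤ a → bump a (unbump a b) ≡ b
bump-unbump {b = zero}  _   = bump-≥ ≤-refl
bump-unbump {b = suc b} b<a = bump-< b<a

unbump-≤ : ∀ {a b} → b ≤ a → unbump a b ≤ a
unbump-≤ {b = zero}  _   = ≤-refl
unbump-≤ {b = suc b} b<a = <⇒≤ b<a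

halfPeriodic : ∀ {k} a b d → b ≤ a → d ≤ a → a ≤ k → HalfPeriodic k (a , b , d)
halfPeriodic {k} a b d b≤a d≤a a≤k with m≤n⇒m<n∨m≡n b≤a | m≤n⇒m<n∨m≡n d≤a
... | inj₂ refl | inj₂ refl = halfPeriodic-diagonal a≤k
... | inj₂ refl | inj₁ d<a  = halfPeriodic-corner d<a a≤k
... | inj₁ b<a  | inj₂ refl = halfPeriodic-swapLeaves {k} (halfPeriodic-corner b<a a≤k)
halfPeriodic {k} (suc a) b d _ _ a<k | inj₁ (s≤s b≤a) | inj₁ (s≤s d≤a) =
  subst (HalfPeriodic k) predecessor
    (halfPeriodic-whirlᵗ {k} (halfPeriodic a _ _ (unbump-≤ b≤a) (unbump-≤ d≤a) (<⇒≤ a<k)))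
  where
  predecessor : whirlᵗ k (a , unbump a b , unbump a d) ≡ (suc a , b , d)
  predecessor = trans (whirlᵗ-below a<k)
                      (cong₂ (λ b′ d′ → suc a , b′ , d′) (bump-unbump b≤a) (bump-unbump d≤a))

whirlᵗ-period : ∀ {k a b d} → b ≤ a → d ≤ a → a ≤ k →
                iter (2 * (k + 2)) (whirlᵗ k) (a , b , d) ≡ (a , b , d)
whirlᵗ-period {k} {a} {b} {d} b≤a d≤a a≤k = begin
  iter (2 * (k + 2)) W s                  ≡⟨ iter-+ (k + 2) (k + 2 + 0) W s ⟩
  iter (k + 2) W (iter (k + 2 + 0) W s)
    ≡⟨ cong (λ n → iter (k + 2) W (iter n W s)) (+-identityʳ (k + 2)) ⟩
  iter (k + 2) W (iter (k + 2) W s)       ≡⟨ cong (iter (k + 2) W) half ⟩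
  iter (k + 2) W (swapLeaves s)           ≡⟨ halfPeriodic-swapLeaves {k} half ⟩
  s                                       ∎
  where
  W = whirlᵗ k
  s = (a , b , d)
  half = halfPeriodic a b d b≤a d≤a a≤k

toℕ-inc-< : ∀ {k} (i : Fin (suc k)) → toℕ i < k → toℕ (inc i) ≡ suc (toℕ i)
toℕ-inc-< i i<k = trans (toℕ-fromℕ< _) (m<n⇒m%n≡m (s≤s i<k))

toℕ-inc-max : ∀ {k} (i : Fin (suc k)) → toℕ i ≡ k → toℕ (inc i) ≡ 0
toℕ-inc-max {k} i i≡k =
  trans (toℕ-fromℕ< _) (trans (cong (λ n → suc n % suc k) i≡k) (n%n≡0 (suc k)))

toℕ-iter-inc : ∀ {k} j (i : Fin (suc k)) → toℕ i + j ≤ k → toℕ (iter j inc i) ≡ toℕ i + j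
toℕ-iter-inc zero    i _ = sym (+-identityʳ _)
toℕ-iter-inc {k} (suc j) i i+1+j≤k = begin
  toℕ (inc (iter j inc i))      ≡⟨ toℕ-inc-< (iter j inc i) (subst (_< k) (sym below) i+j<k) ⟩
  suc (toℕ (iter j inc i))      ≡⟨ cong suc below ⟩
  suc (toℕ i + j)               ≡⟨ sym (+-suc (toℕ i) j) ⟩
  toℕ i + suc j                 ∎
  where
  i+j<k : toℕ i + j < k
  i+j<k = subst (_≤ k) (+-suc (toℕ i) j) i+1+j≤k
  below : toℕ (iter j inc i) ≡ toℕ i + j
  below = toℕ-iter-inc j i (<⇒≤ i+j<k)

toℕ-iter-inc-wrap : ∀ {k} (i : Fin (suc k)) → toℕ i ≡ k → ∀ {j} → j ≤ k →
                    toℕ (iter (suc j) inc i) ≡ j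
toℕ-iter-inc-wrap {k} i i≡k {j} j≤k = begin
  toℕ (iter (suc j) inc i) ≡⟨ cong toℕ (iter-suc-inner j inc i) ⟩
  toℕ (iter j inc (inc i)) ≡⟨ toℕ-iter-inc j (inc i) (subst (λ n → n + j ≤ k) (sym zero-after) j≤k) ⟩
  toℕ (inc i) + j          ≡⟨ cong (_+ j) zero-after ⟩
  j                        ∎
  where
  zero-after : toℕ (inc i) ≡ 0
  zero-after = toℕ-inc-max i i≡k

update-same : ∀ {k} (g : Fun k) x v → update g x v x ≡ v
update-same g c v = refl
update-same g ℓ v = refl
update-same g r v = refl

update-update : ∀ {k} (g : Fun k) x u v → update (update g x u) x v ≗ update g x v
update-update g c u v c = refl
update-update g c u v ℓ = refl
update-update g c u v r = refl
update-update g ℓ u v c = refl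
update-update g ℓ u v ℓ = refl
update-update g ℓ u v r = refl
update-update g r u v c = refl
update-update g r u v ℓ = refl
update-update g r u v r = refl

InF-resp-≗ : ∀ {k} {g h : Fun k} → g ≗ h → InF g → InF h
InF-resp-≗ g≗h (ℓ≤c , r≤c) =
  subst₂ (λ i j → toℕ i ≤ toℕ j) (g≗h ℓ) (g≗h c) ℓ≤c ,
  subst₂ (λ i j → toℕ i ≤ toℕ j) (g≗h r) (g≗h c) r≤c

whirlLoop-first : ∀ {k} x m n (g : Fun k) → m < n →
                  (∀ j → j < m → ¬ InF (update g x (iter (suc j) inc (g x)))) →
                  InF (update g x (iter (suc m) inc (g x))) →
                  whirlLoop n x g ≗ update g x (iter (suc m) inc (g x))
whirlLoop-first x zero (suc n) g _ _ valid with inF? (update g x (inc (g x)))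
... | yes _      = λ _ → refl
... | no invalid = ⊥-elim (invalid valid)
whirlLoop-first x (suc m) (suc n) g (s≤s m<n) invalid valid with inF? (update g x (inc (g x)))
... | yes first = ⊥-elim (invalid 0 z<s first)
... | no _      = λ y → trans (whirlLoop-first x m n g′ m<n invalid′ valid′ y) (shift (suc m) y)
  where
  g′ = update g x (inc (g x))
  shift : ∀ j → update g′ x (iter j inc (g′ x)) ≗ update g x (iter (suc j) inc (g x))
  shift j y = trans (update-update g x _ _ y)
                    (cong (λ v → update g x v y)
                          (trans (cong (iter j inc) (update-same g x _))
                                 (sym (iter-suc-inner j inc (g x)))))
  invalid′ : ∀ j → j < m → ¬ InF (update g′ x (iter (suc j) inc (g′ x)))
  invalid′ j j<m = invalid (suc j) (s≤s j<m) ∘ InF-resp-≗ (shift (suc j))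
  valid′ : InF (update g′ x (iter (suc m) inc (g′ x)))
  valid′ = InF-resp-≗ (λ y → sym (shift (suc m) y)) valid

triple : ∀ {k} → Fun k → Triple
triple f = toℕ (f c) , toℕ (f ℓ) , toℕ (f r)

triple-resp-≗ : ∀ {k} {g h : Fun k} → g ≗ h → triple g ≡ triple h
triple-resp-≗ g≗h =
  cong₂ _,_ (cong toℕ (g≗h c)) (cong₂ _,_ (cong toℕ (g≗h ℓ)) (cong toℕ (g≗h r)))

triple-injective : ∀ {k} {g h : Fun k} → triple g ≡ triple h → g ≗ h
triple-injective e c = toℕ-injective (cong proj₁ e)
triple-injective e ℓ = toℕ-injective (cong (proj₁ ∘ proj₂) e)
triple-injective e r = toℕ-injective (cong (proj₂ ∘ proj₂) e)

Simulates : ∀ {k} → (Fun k → Fun k) → (Triple → Triple) → Set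
Simulates h t = ∀ g → InF g → InF (h g) × triple (h g) ≡ t (triple g)

simulates-∘ : ∀ {k} {h h′ : Fun k → Fun k} {t t′} →
              Simulates h t → Simulates h′ t′ → Simulates (h′ ∘ h) (t′ ∘ t)
simulates-∘ {h = h} {t′ = t′} sim sim′ g inF with sim g inF
... | inF₁ , e₁ with sim′ (h g) inF₁
... | inF₂ , e₂ = inF₂ , trans e₂ (cong t′ e₁)

simulates-iter : ∀ {k} {h : Fun k → Fun k} {t} n → Simulates h t → Simulates (iter n h) (iter n t)
simulates-iter             zero    sim g inF = inF , refl
simulates-iter {h = h} {t} (suc n) sim       =
  simulates-∘ {h = iter n h} {h} {iter n t} {t} (simulates-iter n sim) sim

WhirlsTo : ∀ {k} → V → Fun k → Triple → Set
WhirlsTo x g t = ∃[ v ] InF (update g x v) × whirlAt x g ≗ update g x v × triple (update g x v) ≡ t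

whirlsTo-simulates : ∀ {k} x → (∀ (g : Fun k) → InF g → WhirlsTo x g (whirlAtᵗ k x (triple g))) →
                     Simulates (whirlAt x) (whirlAtᵗ k x)
whirlsTo-simulates x moves g inF with moves g inF
... | v , valid , w≗ , e = InF-resp-≗ (λ y → sym (w≗ y)) valid , trans (triple-resp-≗ w≗) e

data Leaf : V → Set where
  ℓ-leaf : Leaf ℓ
  r-leaf : Leaf r

module _ {k} (g : Fun k) where

  leaf-below : ∀ {y} → Leaf y → InF g → toℕ (g y) ≤ toℕ (g c)
  leaf-below ℓ-leaf (ℓ≤c , _) = ℓ≤c
  leaf-below r-leaf (_ , r≤c) = r≤c

  leaf-accept : ∀ {y v} → Leaf y → InF g → toℕ v ≤ toℕ (g c) → InF (update g y v)
  leaf-accept ℓ-leaf (_ , r≤c) v≤c = v≤c , r≤c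
  leaf-accept r-leaf (ℓ≤c , _) v≤c = ℓ≤c , v≤c

  leaf-reject : ∀ {y v} → Leaf y → toℕ (g c) < toℕ v → ¬ InF (update g y v)
  leaf-reject ℓ-leaf c<v (v≤c , _) = <⇒≱ c<v v≤c
  leaf-reject r-leaf c<v (_ , v≤c) = <⇒≱ c<v v≤c

  leaf-triple : ∀ {y v} → Leaf y → toℕ v ≡ bump (toℕ (g c)) (toℕ (g y)) →
                triple (update g y v) ≡ whirlAtᵗ k y (triple g)
  leaf-triple ℓ-leaf e = cong (λ b → toℕ (g c) , b , toℕ (g r)) e
  leaf-triple r-leaf e = cong (λ d → toℕ (g c) , toℕ (g ℓ) , d) e

  whirlAt-leaf : ∀ {y} → Leaf y → InF g → WhirlsTo y g (whirlAtᵗ k y (triple g))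
  whirlAt-leaf {y} leaf inF with toℕ (g y) <? toℕ (g c)
  ... | yes b<a =
    inc (g y) , valid , whirlLoop-first y 0 (suc k) g z<s (λ _ ()) valid ,
    leaf-triple leaf (trans up (sym (bump-< b<a)))
    where
    up : toℕ (inc (g y)) ≡ suc (toℕ (g y))
    up = toℕ-inc-< (g y) (<-≤-trans b<a (toℕ≤pred[n] (g c)))
    valid : InF (update g y (inc (g y)))
    valid = leaf-accept leaf inF (subst (_≤ toℕ (g c)) (sym up) b<a)
  ... | no b≮a =
    iter (suc m) inc (g y) , valid ,
    whirlLoop-first y m (suc k) g (s≤s (m∸n≤m k (toℕ (g y)))) overshoot valid ,
    leaf-triple leaf (trans wraps (sym (bump-≥ (≮⇒≥ b≮a))))
    where
    m = k ∸ toℕ (g y)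
    b+m≡k : toℕ (g y) + m ≡ k
    b+m≡k = m+[n∸m]≡n (toℕ≤pred[n] (g y))
    wraps : toℕ (iter (suc m) inc (g y)) ≡ 0
    wraps = toℕ-inc-max _ (trans (toℕ-iter-inc m (g y) (≤-reflexive b+m≡k)) b+m≡k)
    valid : InF (update g y (iter (suc m) inc (g y)))
    valid = leaf-accept leaf inF (subst (_≤ toℕ (g c)) (sym wraps) z≤n)
    overshoot : ∀ j → j < m → ¬ InF (update g y (iter (suc j) inc (g y)))
    overshoot j j<m = leaf-reject leaf (subst (toℕ (g c) <_) (sym climbed) a<b+1+j)
      where
      climbed : toℕ (iter (suc j) inc (g y)) ≡ toℕ (g y) + suc j
      climbed = toℕ-iter-inc (suc j) (g y)
                  (subst (toℕ (g y) + suc j ≤_) b+m≡k (+-monoʳ-≤ (toℕ (g y)) j<m))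
      a<b+1+j : toℕ (g c) < toℕ (g y) + suc j
      a<b+1+j = subst (_< toℕ (g y) + suc j) (≤-antisym (leaf-below leaf inF) (≮⇒≥ b≮a))
                      (m<m+n _ z<s)

  whirlAt-root : InF g → WhirlsTo c g (whirlAtᵗ k c (triple g))
  whirlAt-root (ℓ≤c , r≤c) with toℕ (g c) <? k
  ... | yes a<k =
    inc (g c) , valid , whirlLoop-first c 0 (suc k) g z<s (λ _ ()) valid ,
    cong (λ a′ → a′ , toℕ (g ℓ) , toℕ (g r)) (trans up (sym (raise-< a<k)))
    where
    up : toℕ (inc (g c)) ≡ suc (toℕ (g c))
    up = toℕ-inc-< (g c) a<k
    valid : InF (update g c (inc (g c)))
    valid = subst (toℕ (g ℓ) ≤_) (sym up) (m≤n⇒m≤1+n ℓ≤c) ,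
            subst (toℕ (g r) ≤_) (sym up) (m≤n⇒m≤1+n r≤c)
  ... | no a≮k =
    iter (suc m) inc (g c) , valid , whirlLoop-first c m (suc k) g (s≤s m≤k) undershoot valid ,
    cong (λ a′ → a′ , toℕ (g ℓ) , toℕ (g r)) (trans (lands m≤k) (sym (raise-≥ (≮⇒≥ a≮k))))
    where
    m = toℕ (g ℓ) ⊔ toℕ (g r)
    m≤k : m ≤ k
    m≤k = ⊔-lub (toℕ≤pred[n] (g ℓ)) (toℕ≤pred[n] (g r))
    lands : ∀ {j} → j ≤ k → toℕ (iter (suc j) inc (g c)) ≡ j
    lands = toℕ-iter-inc-wrap (g c) (≤-antisym (toℕ≤pred[n] (g c)) (≮⇒≥ a≮k))
    valid : InF (update g c (iter (suc m) inc (g c)))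
    valid = subst (toℕ (g ℓ) ≤_) (sym (lands m≤k)) (m≤m⊔n _ _) ,
            subst (toℕ (g r) ≤_) (sym (lands m≤k)) (m≤n⊔m _ _)
    undershoot : ∀ j → j < m → ¬ InF (update g c (iter (suc j) inc (g c)))
    undershoot j j<m (ℓ≤v , r≤v) =
      <⇒≱ j<m (subst (m ≤_) (lands (<⇒≤ (<-≤-trans j<m m≤k))) (⊔-lub ℓ≤v r≤v))

whirlAt-simulates : ∀ {k} x → Simulates (whirlAt {k} x) (whirlAtᵗ k x)
whirlAt-simulates c = whirlsTo-simulates c whirlAt-root
whirlAt-simulates ℓ = whirlsTo-simulates ℓ λ g → whirlAt-leaf g ℓ-leaf
whirlAt-simulates r = whirlsTo-simulates r λ g → whirlAt-leaf g r-leaf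

whirl-simulates : ∀ {k} → Simulates (whirl {k}) (whirlᵗ k)
whirl-simulates {k} =
  simulates-∘ {h = whirlAt r ∘ whirlAt ℓ} {whirlAt c} {whirlAtᵗ k r ∘ whirlAtᵗ k ℓ} {whirlAtᵗ k c}
    (simulates-∘ {h = whirlAt ℓ} {whirlAt r} {whirlAtᵗ k ℓ} {whirlAtᵗ k r}
                 (whirlAt-simulates ℓ) (whirlAt-simulates r))
    (whirlAt-simulates c)

corollary3p16 : (k : ℕ) → 1 ≤ k → (f : Fun k) → InF f →
                (x : V) → iter (2 * (k + 2)) whirl f x ≡ f x
corollary3p16 k _ f inF@(ℓ≤c , r≤c) = triple-injective (begin
  triple (iter (2 * (k + 2)) whirl f)
    ≡⟨ proj₂ (simulates-iter {h = whirl} {whirlᵗ k} (2 * (k + 2)) whirl-simulates f inF) ⟩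
  iter (2 * (k + 2)) (whirlᵗ k) (triple f)  ≡⟨ whirlᵗ-period ℓ≤c r≤c (toℕ≤pred[n] (f c)) ⟩
  triple f                                  ∎)
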